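{- Every cobipartite $k$-tree is a linear $k$-tree.
   Context: A graph is cobipartite if its vertex set can be partitioned into two cliques. For an integer $k\ge1$, a $k$-tree is a graph constructed by starting with a $(k+1)$-clique and repeating (zero or more times) the step: choose $k$ vertices inducing a clique and add a new vertex adjacent to exactly those $k$ vertices. A linear $k$-tree is a $k$-tree that either is a $(k+1)$-clique or has exactly two vertices of degree $k$. -}

module Defs where

open import Data.Nat using (ℕ; zero; suc; _+_; _≤_; _<_; _<ᵇ_)
open import Data.Bool using (Bool; true; false; if_then_else_)
open import Data.Fin using (Fin; toℕ)
open import Data.Fin.Permutation using (Permutation′; _⟨$⟩ʳ_)
open import Data.List using (List; map; allFin)
open import Data.Nat.ListAction using (sum)
open import Data.Product using (Σ; _×_; ∃; ∃-syntax; _,_)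
open import Data.Sum using (_⊎_)
open import Relation.Binary.PropositionalEquality using (_≡_; _≢_)

record Graph (n : ℕ) : Set where
  field
    adj    : Fin n → Fin n → Bool
    sym    : ∀ u v → adj u v ≡ adj v u
    irrefl : ∀ v → adj v v ≡ false
open Graph public

countV : ∀ {n} → (Fin n → Bool) → ℕ
countV {n} p = sum (map (λ w → if p w then 1 else 0) (allFin n))

degree : ∀ {n} → Graph n → Fin n → ℕ
degree G v = countV (adj G v)

IsCliqueSet : ∀ {n} → Graph n → (Fin n → Bool) → Set
IsCliqueSet G S = ∀ u v → S u ≡ true → S v ≡ true → u ≢ v → adj G u v ≡ true

IsComplete : ∀ {n} → Graph n → Set
IsComplete G = ∀ u v → u ≢ v → adj G u v ≡ true

-- Cobipartite: the vertex set can be partitioned into two cliques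
-- (the part of v is given by c v).
IsCobipartite : ∀ {n} → Graph n → Set
IsCobipartite {n} G =
  Σ (Fin n → Bool) λ c → ∀ u v → u ≢ v → c u ≡ c v → adj G u v ≡ true

earlierNbr : ∀ {n} → Graph n → Permutation′ n → Fin n → Fin n → Bool
earlierNbr G σ i j = if toℕ j <ᵇ toℕ i then adj G (σ ⟨$⟩ʳ i) (σ ⟨$⟩ʳ j) else false

-- The construction of a k-tree, unfolded along the order in which the
-- vertices are created: σ ⟨$⟩ʳ i is the i-th created vertex.  The first
-- k+1 vertices form the initial (k+1)-clique; every later vertex is
-- adjacent, among the previously created vertices, to exactly k vertices,
-- and these induce a clique.  (Later edges of a vertex are exactly those
-- created when later vertices are added.)
record KTreeConstruction (k : ℕ) {n : ℕ} (G : Graph n) : Set where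
  field
    σ           : Permutation′ n
    enough      : suc k ≤ n
    initClique  : ∀ i j → toℕ i < suc k → toℕ j < suc k → i ≢ j →
                  adj G (σ ⟨$⟩ʳ i) (σ ⟨$⟩ʳ j) ≡ true
    stepCount   : ∀ i → suc k ≤ toℕ i →
                  countV (λ j → earlierNbr G σ i j) ≡ k
    stepClique  : ∀ i → suc k ≤ toℕ i →
                  ∀ j j′ → earlierNbr G σ i j ≡ true → earlierNbr G σ i j′ ≡ true → j ≢ j′ →
                  adj G (σ ⟨$⟩ʳ j) (σ ⟨$⟩ʳ j′) ≡ true

IsKTree : ℕ → ∀ {n} → Graph n → Set
IsKTree k G = KTreeConstruction k G

ExactlyTwoOfDegree : ℕ → ∀ {n} → Graph n → Set
ExactlyTwoOfDegree k {n} G =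
  Σ (Fin n) λ u → Σ (Fin n) λ v →
    u ≢ v × degree G u ≡ k × degree G v ≡ k ×
    (∀ w → degree G w ≡ k → w ≡ u ⊎ w ≡ v)

IsLinearKTree : ℕ → ∀ {n} → Graph n → Set
IsLinearKTree k {n} G =
  IsKTree k G × ((n ≡ suc k × IsComplete G) ⊎ ExactlyTwoOfDegree k G)

{-# OPTIONS --safe #-}
-- Number the vertices in creation order.  Each vertex has exactly k neighbours
-- that are initial or created before it, so its degree is k plus the number of
-- its neighbours created after both it and the initial clique: the vertices of
-- degree k are those without such later neighbours.  Two of them are never
-- adjacent: the later one would be a later neighbour of the other, unless both
-- are initial, and then the first vertex added after the initial clique, which
-- misses exactly one initial vertex, is a later neighbour of one of them.  In a
-- cobipartite graph an independent set has at most two vertices.  Conversely,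
-- once a vertex is added there are two nonadjacent vertices of degree k: each
-- new vertex, whose earlier neighbours form a clique, misses one vertex of the
-- current pair and forms the next pair with it.

module Submission where

open import Defs hiding (sym)
open import Data.Bool using (Bool; true; false; if_then_else_; _∧_; not; T)
open import Data.Bool.Properties using (∧-comm; ∧-zeroʳ)
open import Data.Empty using (⊥-elim)
open import Data.Fin using (Fin; zero; suc; toℕ; fromℕ<)
open import Data.Fin.Properties using (_≟_; toℕ-injective; toℕ-fromℕ<; toℕ<n; <⇒≢)
open import Data.Fin.Permutation using (Permutation′; _⟨$⟩ʳ_; _⟨$⟩ˡ_; inverseʳ; inverseˡ)
open import Data.List.Properties using (map-tabulate)
open import Data.Nat using (ℕ; zero; suc; _+_; _⊔_; _≤_; _<_; _<ᵇ_; _≤′_; ≤′-refl; ≤′-step; s≤s)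
open import Data.Nat.Properties
  using (+-0-commutativeMonoid; +-comm; +-identityʳ; +-cancelˡ-≡; suc-injective; _≤?_; _<?_; <-cmp;
         ≤-refl; ≤-reflexive; ≤-trans; ≤-antisym; ≤-pred; <⇒≤; <-≤-trans; ≤⇒≯; ≰⇒>; ≮⇒≥; <ᵇ⇒<;
         m<n⇒m<1+n; m<1+n⇒m<n∨m≡n; ≤′⇒≤; ≤⇒≤′; ⊔-lub; m≤m⊔n; m≤n⊔m; m≥n⇒m⊔n≡m; m≤n⇒m⊔n≡n)
open import Data.Nat.ListAction using (sum)
open import Data.Product using (∃; _×_; _,_; proj₁)
open import Data.Unit using (tt)
open import Data.Sum using (_⊎_; inj₁; inj₂; [_,_]′)
open import Function using (_∘_; id)
open import Relation.Binary.Definitions using (tri<; tri≈; tri>)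
open import Relation.Binary.PropositionalEquality
open import Relation.Nullary using (does; yes; no)
open import Relation.Nullary.Decidable using (dec-true; dec-false)
open import Algebra.Properties.CommutativeMonoid.Sum +-0-commutativeMonoid
  using (sum-syntax; ∑-distrib-+; sum-permute; sum-cong-≗)

<⇒<ᵇ≡true : ∀ {m n} → m < n → (m <ᵇ n) ≡ true
<⇒<ᵇ≡true {m} {n} = dec-true (m <? n)

<ᵇ≡true⇒< : ∀ {m n} → (m <ᵇ n) ≡ true → m < n
<ᵇ≡true⇒< {m} {n} m<ᵇn = <ᵇ⇒< m n (subst T (sym m<ᵇn) tt)

≥⇒<ᵇ≡false : ∀ {m n} → n ≤ m → (m <ᵇ n) ≡ false
≥⇒<ᵇ≡false {m} {n} n≤m = dec-false (m <? n) (≤⇒≯ n≤m)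

indicator : Bool → ℕ
indicator b = if b then 1 else 0

countV-suc : ∀ {n} (p : Fin (suc n) → Bool) →
             countV p ≡ indicator (p zero) + countV (p ∘ suc)
countV-suc {n} p = cong (λ xs → indicator (p zero) + sum xs)
  (trans (map-tabulate suc f) (sym (map-tabulate id (f ∘ suc))))
  where
  f : Fin (suc n) → ℕ
  f = indicator ∘ p

countV≡∑ : ∀ {n} (p : Fin n → Bool) → countV p ≡ ∑[ j < n ] indicator (p j)
countV≡∑ {zero}  p = refl
countV≡∑ {suc n} p = trans (countV-suc p) (cong (indicator (p zero) +_) (countV≡∑ (p ∘ suc)))

countV-cong : ∀ {n} {p q : Fin n → Bool} → (∀ j → p j ≡ q j) → countV p ≡ countV q
countV-cong {p = p} {q} p≗q = begin
  countV p                     ≡⟨ countV≡∑ p ⟩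
  ∑[ j < _ ] indicator (p j)   ≡⟨ sum-cong-≗ (cong indicator ∘ p≗q) ⟩
  ∑[ j < _ ] indicator (q j)   ≡⟨ countV≡∑ q ⟨
  countV q                     ∎
  where open ≡-Reasoning

countV-permute : ∀ {n} (p : Fin n → Bool) (π : Permutation′ n) →
                 countV p ≡ countV (p ∘ (π ⟨$⟩ʳ_))
countV-permute p π = begin
  countV p                                 ≡⟨ countV≡∑ p ⟩
  ∑[ j < _ ] indicator (p j)               ≡⟨ sum-permute (indicator ∘ p) π ⟩
  ∑[ j < _ ] indicator (p (π ⟨$⟩ʳ j))      ≡⟨ countV≡∑ (p ∘ (π ⟨$⟩ʳ_)) ⟨
  countV (p ∘ (π ⟨$⟩ʳ_))                   ∎
  where open ≡-Reasoning

countV-split : ∀ {n} (q p : Fin n → Bool) →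
               countV p ≡ countV (λ j → q j ∧ p j) + countV (λ j → not (q j) ∧ p j)
countV-split q p = begin
  countV p
    ≡⟨ countV≡∑ p ⟩
  ∑[ j < _ ] indicator (p j)
    ≡⟨ sum-cong-≗ (λ j → indicator-split (q j) (p j)) ⟩
  ∑[ j < _ ] (indicator (q j ∧ p j) + indicator (not (q j) ∧ p j))
    ≡⟨ ∑-distrib-+ (λ j → indicator (q j ∧ p j)) (λ j → indicator (not (q j) ∧ p j)) ⟩
  ∑[ j < _ ] indicator (q j ∧ p j) + ∑[ j < _ ] indicator (not (q j) ∧ p j)
    ≡⟨ cong₂ _+_ (countV≡∑ (λ j → q j ∧ p j)) (countV≡∑ (λ j → not (q j) ∧ p j)) ⟨
  countV (λ j → q j ∧ p j) + countV (λ j → not (q j) ∧ p j)  ∎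
  where
  open ≡-Reasoning
  indicator-split : ∀ a b → indicator b ≡ indicator (a ∧ b) + indicator (not a ∧ b)
  indicator-split true  false = refl
  indicator-split true  true  = refl
  indicator-split false b     = refl

countV-false : ∀ {n} → countV {n} (λ _ → false) ≡ 0
countV-false {zero}  = refl
countV-false {suc n} = trans (countV-suc {n} (λ _ → false)) (countV-false {n})

countV-<ᵇ : ∀ {n m} → m ≤ n → countV {n} (λ j → toℕ j <ᵇ m) ≡ m
countV-<ᵇ {n}     {zero}  _         = countV-false {n}
countV-<ᵇ {suc n} {suc m} (s≤s m≤n) =
  trans (countV-suc {n} (λ j → toℕ j <ᵇ suc m)) (cong suc (countV-<ᵇ m≤n))

countV-≟ : ∀ {n} (i : Fin n) → countV (λ j → does (j ≟ i)) ≡ 1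
countV-≟ {suc n} zero    =
  trans (countV-suc {n} (λ j → does (j ≟ zero))) (cong suc (countV-false {n}))
countV-≟ {suc n} (suc i) =
  trans (countV-suc {n} (λ j → does (j ≟ suc i))) (countV-≟ i)

countV-remove : ∀ {n} (p : Fin n → Bool) {i} → p i ≡ true →
                countV p ≡ suc (countV (λ j → not (does (j ≟ i)) ∧ p j))
countV-remove p {i} pi = begin
  countV p
    ≡⟨ countV-split (λ j → does (j ≟ i)) p ⟩
  countV (λ j → does (j ≟ i) ∧ p j) + countV (λ j → not (does (j ≟ i)) ∧ p j)
    ≡⟨ cong (_+ countV (λ j → not (does (j ≟ i)) ∧ p j)) (trans (countV-cong at-i) (countV-≟ i)) ⟩
  suc (countV (λ j → not (does (j ≟ i)) ∧ p j)) ∎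
  where
  open ≡-Reasoning
  at-i : ∀ j → does (j ≟ i) ∧ p j ≡ does (j ≟ i)
  at-i j with j ≟ i
  ... | yes refl = pi
  ... | no _     = refl

countV≡0⇒¬p : ∀ {n} (p : Fin n → Bool) → countV p ≡ 0 → ∀ j → p j ≢ true
countV≡0⇒¬p p none j pj with () ← trans (sym none) (countV-remove p pj)

countV≡1⇒unique : ∀ {n} (p : Fin n → Bool) {a b} → countV p ≡ 1 →
                  p a ≡ true → p b ≡ true → a ≡ b
countV≡1⇒unique p {a} {b} one pa pb
  with b ≟ a | countV≡0⇒¬p (λ j → not (does (j ≟ a)) ∧ p j)
                 (suc-injective (trans (sym (countV-remove p pa)) one)) b
... | yes b≡a | _      = sym b≡a
... | no  _   | b∉rest = ⊥-elim (b∉rest pb)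

countV-witness : ∀ {n} (p : Fin n → Bool) → 0 < countV p → ∃ λ j → p j ≡ true
countV-witness {suc n} p pos with p zero in p0 | subst (0 <_) (countV-suc p) pos
... | true  | _    = zero , p0
... | false | pos′ with j , pj ← countV-witness (p ∘ suc) pos′ = suc j , pj

Independent : ∀ {n} → Graph n → (Fin n → Set) → Set
Independent G P = ∀ u w → P u → P w → adj G u w ≢ true

Bool-pigeonhole : ∀ (x y z : Bool) → x ≡ y ⊎ x ≡ z ⊎ y ≡ z
Bool-pigeonhole false false _     = inj₁ refl
Bool-pigeonhole true  true  _     = inj₁ refl
Bool-pigeonhole false true  false = inj₂ (inj₁ refl)
Bool-pigeonhole true  false true  = inj₂ (inj₁ refl)
Bool-pigeonhole false true  true  = inj₂ (inj₂ refl)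
Bool-pigeonhole true  false false = inj₂ (inj₂ refl)

cobipartite-independent : ∀ {n} {G : Graph n} {P : Fin n → Set} →
                          IsCobipartite G → Independent G P →
                          ∀ {u v w} → u ≢ v → P u → P v → P w → w ≡ u ⊎ w ≡ v
cobipartite-independent (c , cob) indep {u} {v} {w} u≢v pu pv pw with w ≟ u | w ≟ v
... | yes w≡u | _       = inj₁ w≡u
... | no _    | yes w≡v = inj₂ w≡v
... | no w≢u  | no w≢v  with Bool-pigeonhole (c u) (c v) (c w)
...   | inj₁ cu≡cv        = ⊥-elim (indep u v pu pv (cob u v u≢v cu≡cv))
...   | inj₂ (inj₁ cu≡cw) = ⊥-elim (indep u w pu pw (cob u w (w≢u ∘ sym) cu≡cw))
...   | inj₂ (inj₂ cv≡cw) = ⊥-elim (indep v w pv pw (cob v w (w≢v ∘ sym) cv≡cw))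

module KTreeConstruction-Properties {k n : ℕ} {G : Graph n} (T : KTreeConstruction k G) where
  open KTreeConstruction T

  vertex : Fin n → Fin n
  vertex i = σ ⟨$⟩ʳ i

  index : Fin n → Fin n
  index u = σ ⟨$⟩ˡ u

  vertex-index : ∀ u → vertex (index u) ≡ u
  vertex-index u = inverseʳ σ

  vertex-injective : ∀ {i j} → vertex i ≡ vertex j → i ≡ j
  vertex-injective e = trans (sym (inverseˡ σ)) (trans (cong index e) (inverseˡ σ))

  A : Fin n → Fin n → Bool
  A i j = adj G (vertex i) (vertex j)

  A-sym : ∀ i j → A i j ≡ A j i
  A-sym i j = Graph.sym G (vertex i) (vertex j)

  A-irrefl : ∀ i → A i i ≡ false
  A-irrefl i = irrefl G (vertex i)

  initial : Fin n → Bool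
  initial j = toℕ j <ᵇ suc k

  later : Fin n → Fin n → Bool
  later i j = toℕ i ⊔ k <ᵇ toℕ j

  laterNbr : Fin n → Fin n → Bool
  laterNbr i j = later i j ∧ A i j

  earlierNbr≡ : ∀ i j → earlierNbr G σ i j ≡ (toℕ j <ᵇ toℕ i) ∧ A i j
  earlierNbr≡ i j with toℕ j <ᵇ toℕ i
  ... | true  = refl
  ... | false = refl

  earlierNbr-intro : ∀ {i j} → toℕ j < toℕ i → A i j ≡ true → earlierNbr G σ i j ≡ true
  earlierNbr-intro {i} {j} j<i aij rewrite earlierNbr≡ i j | <⇒<ᵇ≡true j<i = aij

  nonLaterNbr≡earlierNbr : ∀ {i} → k < toℕ i → ∀ j → not (later i j) ∧ A i j ≡ earlierNbr G σ i j
  nonLaterNbr≡earlierNbr {i} k<i j rewrite earlierNbr≡ i j | m≥n⇒m⊔n≡m (<⇒≤ k<i)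
    with <-cmp (toℕ j) (toℕ i)
  ... | tri< j<i _ _ rewrite <⇒<ᵇ≡true j<i | ≥⇒<ᵇ≡false (<⇒≤ j<i) = refl
  ... | tri≈ _ j≡i _ rewrite toℕ-injective j≡i | ≥⇒<ᵇ≡false (≤-refl {toℕ i}) | A-irrefl i = refl
  ... | tri> _ _ i<j rewrite <⇒<ᵇ≡true i<j | ≥⇒<ᵇ≡false (<⇒≤ i<j) = refl

  nonLaterNbr≡otherInitial : ∀ {i} → toℕ i ≤ k →
                             ∀ j → not (later i j) ∧ A i j ≡ not (does (j ≟ i)) ∧ initial j
  nonLaterNbr≡otherInitial {i} i≤k j rewrite m≤n⇒m⊔n≡n i≤k with j ≟ i
  ... | yes refl rewrite ≥⇒<ᵇ≡false i≤k | A-irrefl i = refl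
  ... | no j≢i with toℕ j ≤? k
  ...   | yes j≤k rewrite ≥⇒<ᵇ≡false j≤k | <⇒<ᵇ≡true (s≤s j≤k)
                        | initClique i j (s≤s i≤k) (s≤s j≤k) (j≢i ∘ sym) = refl
  ...   | no j≰k  rewrite <⇒<ᵇ≡true (≰⇒> j≰k) | ≥⇒<ᵇ≡false (≰⇒> j≰k) = refl

  countV-nonLaterNbr≡k : ∀ i → countV (λ j → not (later i j) ∧ A i j) ≡ k
  countV-nonLaterNbr≡k i with k <? toℕ i
  ... | yes k<i = trans (countV-cong (nonLaterNbr≡earlierNbr k<i)) (stepCount i k<i)
  ... | no  k≮i = suc-injective (begin
    suc (countV (λ j → not (later i j) ∧ A i j))
      ≡⟨ cong suc (countV-cong (nonLaterNbr≡otherInitial i≤k)) ⟩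
    suc (countV (λ j → not (does (j ≟ i)) ∧ initial j))
      ≡⟨ countV-remove initial (<⇒<ᵇ≡true (s≤s i≤k)) ⟨
    countV initial
      ≡⟨ countV-<ᵇ enough ⟩
    suc k ∎)
    where
    open ≡-Reasoning
    i≤k : toℕ i ≤ k
    i≤k = ≮⇒≥ k≮i

  degree≡k+countV-laterNbr : ∀ i → degree G (vertex i) ≡ k + countV (laterNbr i)
  degree≡k+countV-laterNbr i = begin
    degree G (vertex i)
      ≡⟨ countV-permute (adj G (vertex i)) σ ⟩
    countV (A i)
      ≡⟨ countV-split (later i) (A i) ⟩
    countV (laterNbr i) + countV (λ j → not (later i j) ∧ A i j)
      ≡⟨ cong (countV (laterNbr i) +_) (countV-nonLaterNbr≡k i) ⟩
    countV (laterNbr i) + k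
      ≡⟨ +-comm _ k ⟩
    k + countV (laterNbr i) ∎
    where open ≡-Reasoning

  k-leaf⇒¬laterNbr : ∀ {i} → degree G (vertex i) ≡ k → ∀ j → laterNbr i j ≢ true
  k-leaf⇒¬laterNbr {i} deg = countV≡0⇒¬p (laterNbr i)
    (+-cancelˡ-≡ k _ 0 (trans (sym (degree≡k+countV-laterNbr i)) (trans deg (sym (+-identityʳ k)))))

  no-laterNbr⇒k-leaf : ∀ {i} → (∀ j → laterNbr i j ≡ false) → degree G (vertex i) ≡ k
  no-laterNbr⇒k-leaf {i} none = begin
    degree G (vertex i)         ≡⟨ degree≡k+countV-laterNbr i ⟩
    k + countV (laterNbr i)     ≡⟨ cong (k +_) (trans (countV-cong none) (countV-false {n})) ⟩
    k + 0                       ≡⟨ +-identityʳ k ⟩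
    k                           ∎
    where open ≡-Reasoning

  laterNbr-intro : ∀ {i j} → toℕ i < toℕ j → k < toℕ j → A i j ≡ true → laterNbr i j ≡ true
  laterNbr-intro {i} {j} i<j k<j aij rewrite <⇒<ᵇ≡true {toℕ i ⊔ k} (⊔-lub i<j k<j) = aij

  n≡k+1⇒complete : n ≡ suc k → IsComplete G
  n≡k+1⇒complete n≡k+1 u w u≢w = subst₂ (λ x y → adj G x y ≡ true) (vertex-index u) (vertex-index w)
    (initClique (index u) (index w) (isInitial (index u)) (isInitial (index w))
      (λ e → u≢w (trans (sym (vertex-index u)) (trans (cong vertex e) (vertex-index w)))))
    where
    isInitial : ∀ i → toℕ i < suc k
    isInitial i = subst (toℕ i <_) n≡k+1 (toℕ<n i)

  added-misses-nonedge : ∀ {q a b} → k < toℕ q → toℕ a < toℕ q → toℕ b < toℕ q →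
                         a ≢ b → A a b ≡ false → A q a ≡ false ⊎ A q b ≡ false
  added-misses-nonedge {q} {a} {b} k<q a<q b<q a≢b a≁b with A q a in qa | A q b in qb
  ... | false | _     = inj₁ refl
  ... | true  | false = inj₂ refl
  ... | true  | true  with () ← trans (sym a≁b)
    (stepClique q k<q a b (earlierNbr-intro a<q qa) (earlierNbr-intro b<q qb) a≢b)

  -- a has degree k in the k-tree formed by the first m created vertices.
  LeafBelow : ℕ → Fin n → Set
  LeafBelow m a = toℕ a < m × (∀ j → toℕ j < m → laterNbr a j ≡ false)

  leafBelow-early : ∀ {m a} → toℕ a < m → m ≤ suc (toℕ a ⊔ k) → LeafBelow m a
  leafBelow-early {m} {a} a<m m≤ = a<m , notLater
    where
    notLater : ∀ j → toℕ j < m → laterNbr a j ≡ false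
    notLater j j<m rewrite ≥⇒<ᵇ≡false (≤-pred (≤-trans j<m m≤)) = refl

  leafBelow-newest : ∀ q → LeafBelow (suc (toℕ q)) q
  leafBelow-newest q = leafBelow-early ≤-refl (s≤s (m≤m⊔n (toℕ q) k))

  leafBelow-extend : ∀ {m a q} → LeafBelow m a → toℕ q ≡ m → A a q ≡ false → LeafBelow (suc m) a
  leafBelow-extend {m} {a} {q} (a<m , none) q≡m a≁q = m<n⇒m<1+n a<m , none′
    where
    none′ : ∀ j → toℕ j < suc m → laterNbr a j ≡ false
    none′ j j<1+m with m<1+n⇒m<n∨m≡n j<1+m
    ... | inj₁ j<m = none j j<m
    ... | inj₂ j≡m rewrite toℕ-injective (trans j≡m (sym q≡m)) | a≁q = ∧-zeroʳ (later a q)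

  leafBelow-n⇒degree≡k : ∀ {a} → LeafBelow n a → degree G (vertex a) ≡ k
  leafBelow-n⇒degree≡k (_ , none) = no-laterNbr⇒k-leaf (λ j → none j (toℕ<n j))

  record LeafPair (m : ℕ) : Set where
    field
      a b    : Fin n
      a≢b    : a ≢ b
      a-leaf : LeafBelow m a
      b-leaf : LeafBelow m b
      a≁b    : A a b ≡ false

  leafPair-with-newest : ∀ {m} q → toℕ q ≡ m → ∀ x → LeafBelow m x → A q x ≡ false → LeafPair (suc m)
  leafPair-with-newest q q≡m x x-leaf q≁x = record
    { a      = x
    ; b      = q
    ; a≢b    = <⇒≢ (subst (toℕ x <_) (sym q≡m) (proj₁ x-leaf))
    ; a-leaf = leafBelow-extend x-leaf q≡m x≁q
    ; b-leaf = subst (λ m → LeafBelow (suc m) q) q≡m (leafBelow-newest q)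
    ; a≁b    = x≁q
    }
    where
    x≁q : A x q ≡ false
    x≁q = trans (A-sym x q) q≁x

  leafPair-step : ∀ {m} → (m<n : m < n) → k < m → LeafPair m → LeafPair (suc m)
  leafPair-step {m} m<n k<m P =
    [ leafPair-with-newest q q≡m a a-leaf , leafPair-with-newest q q≡m b b-leaf ]′
      (added-misses-nonedge (subst (k <_) (sym q≡m) k<m) (below a-leaf) (below b-leaf) a≢b a≁b)
    where
    open LeafPair P
    q : Fin n
    q = fromℕ< m<n
    q≡m : toℕ q ≡ m
    q≡m = toℕ-fromℕ< m<n
    below : ∀ {x} → LeafBelow m x → toℕ x < toℕ q
    below (x<m , _) = subst (toℕ _ <_) (sym q≡m) x<m

  module AfterInitialClique (k+1<n : suc k < n) where

    first : Fin n
    first = fromℕ< k+1<n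

    toℕ-first : toℕ first ≡ suc k
    toℕ-first = toℕ-fromℕ< k+1<n

    initialNonNbrs-of-first : countV (λ j → not (A first j) ∧ initial j) ≡ 1
    initialNonNbrs-of-first = +-cancelˡ-≡ k _ 1 (begin
      k + countV (λ j → not (A first j) ∧ initial j)
        ≡⟨ cong (_+ countV (λ j → not (A first j) ∧ initial j)) initialNbrs ⟨
      countV (λ j → A first j ∧ initial j) + countV (λ j → not (A first j) ∧ initial j)
        ≡⟨ countV-split (A first) initial ⟨
      countV initial
        ≡⟨ countV-<ᵇ enough ⟩
      suc k
        ≡⟨ +-comm 1 k ⟩
      k + 1 ∎)
      where
      open ≡-Reasoning
      initialNbr≡earlierNbr : ∀ j → A first j ∧ initial j ≡ earlierNbr G σ first j
      initialNbr≡earlierNbr j rewrite earlierNbr≡ first j | toℕ-first = ∧-comm (A first j) (initial j)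
      initialNbrs : countV (λ j → A first j ∧ initial j) ≡ k
      initialNbrs = trans (countV-cong initialNbr≡earlierNbr)
                          (stepCount first (≤-reflexive (sym toℕ-first)))

    initialNonNbr-of-first : ∃ λ a → toℕ a ≤ k × A first a ≡ false
    initialNonNbr-of-first with a , a∈ ← countV-witness (λ j → not (A first j) ∧ initial j)
                                           (≤-reflexive (sym initialNonNbrs-of-first))
      = a , decode a∈
      where
      decode : not (A first a) ∧ initial a ≡ true → toℕ a ≤ k × A first a ≡ false
      decode e with A first a | initial a in a-initial
      decode () | true  | _
      decode () | false | false
      decode _  | false | true = ≤-pred (<ᵇ≡true⇒< a-initial) , refl

    initialNonNbr-of-first-unique : ∀ {a b} → toℕ a ≤ k → toℕ b ≤ k →
                                    A first a ≡ false → A first b ≡ false → a ≡ b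
    initialNonNbr-of-first-unique a≤k b≤k fa fb =
      countV≡1⇒unique (λ j → not (A first j) ∧ initial j) initialNonNbrs-of-first
                      (encode a≤k fa) (encode b≤k fb)
      where
      encode : ∀ {j} → toℕ j ≤ k → A first j ≡ false → not (A first j) ∧ initial j ≡ true
      encode j≤k fj rewrite fj = <⇒<ᵇ≡true (s≤s j≤k)

    initial-laterNbr-of-first : ∀ {i} → toℕ i ≤ k → A first i ≡ true → laterNbr i first ≡ true
    initial-laterNbr-of-first i≤k fi = laterNbr-intro (subst (toℕ _ <_) (sym toℕ-first) (s≤s i≤k))
      (subst (k <_) (sym toℕ-first) ≤-refl) (trans (A-sym _ first) fi)

    initial-k-leaf-unique : ∀ {i j} → toℕ i ≤ k → toℕ j ≤ k →
                            degree G (vertex i) ≡ k → degree G (vertex j) ≡ k → i ≡ j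
    initial-k-leaf-unique {i} {j} i≤k j≤k di dj with A first i in fi | A first j in fj
    ... | true  | _     = ⊥-elim (k-leaf⇒¬laterNbr di first (initial-laterNbr-of-first i≤k fi))
    ... | false | true  = ⊥-elim (k-leaf⇒¬laterNbr dj first (initial-laterNbr-of-first j≤k fj))
    ... | false | false = initialNonNbr-of-first-unique i≤k j≤k fi fj

    k-leaves-nonadjacent-ordered : ∀ {i j} → toℕ i < toℕ j →
                                   degree G (vertex i) ≡ k → degree G (vertex j) ≡ k → A i j ≢ true
    k-leaves-nonadjacent-ordered {i} {j} i<j di dj aij with k <? toℕ j
    ... | yes k<j = k-leaf⇒¬laterNbr di j (laterNbr-intro i<j k<j aij)
    ... | no  k≮j = <⇒≢ i<j (initial-k-leaf-unique (<⇒≤ (<-≤-trans i<j j≤k)) j≤k di dj)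
      where
      j≤k : toℕ j ≤ k
      j≤k = ≮⇒≥ k≮j

    k-leaves-nonadjacent : ∀ i j → degree G (vertex i) ≡ k → degree G (vertex j) ≡ k → A i j ≢ true
    k-leaves-nonadjacent i j di dj aij with <-cmp (toℕ i) (toℕ j)
    ... | tri< i<j _ _ = k-leaves-nonadjacent-ordered i<j di dj aij
    ... | tri> _ _ j<i = k-leaves-nonadjacent-ordered j<i dj di (trans (A-sym j i) aij)
    ... | tri≈ _ i≡j _
      with () ← trans (sym aij) (trans (cong (A i) (sym (toℕ-injective i≡j))) (A-irrefl i))

    k-leaves-independent : Independent G (λ u → degree G u ≡ k)
    k-leaves-independent u w =
      subst₂ (λ x y → degree G x ≡ k → degree G y ≡ k → adj G x y ≢ true)
             (vertex-index u) (vertex-index w) (k-leaves-nonadjacent (index u) (index w))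

    leafPair-base : LeafPair (suc (suc k))
    leafPair-base with a , a≤k , first≁a ← initialNonNbr-of-first =
      leafPair-with-newest first toℕ-first a
        (leafBelow-early (s≤s a≤k) (s≤s (m≤n⊔m (toℕ a) k))) first≁a

    leafPairs : ∀ {m} → suc (suc k) ≤′ m → m ≤ n → LeafPair m
    leafPairs ≤′-refl _ = leafPair-base
    leafPairs (≤′-step k+2≤′m) m<n =
      leafPair-step m<n (<⇒≤ (≤′⇒≤ k+2≤′m)) (leafPairs k+2≤′m (<⇒≤ m<n))

    exactlyTwoOfDegree : IsCobipartite G → ExactlyTwoOfDegree k G
    exactlyTwoOfDegree cob =
      vertex a , vertex b , va≢vb , a-degree , b-degree ,
      λ w w-degree → cobipartite-independent {G = G} cob k-leaves-independent
                         va≢vb a-degree b-degree w-degree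
      where
      open LeafPair (leafPairs (≤⇒≤′ k+1<n) ≤-refl)
      va≢vb : vertex a ≢ vertex b
      va≢vb = a≢b ∘ vertex-injective
      a-degree : degree G (vertex a) ≡ k
      a-degree = leafBelow-n⇒degree≡k a-leaf
      b-degree : degree G (vertex b) ≡ k
      b-degree = leafBelow-n⇒degree≡k b-leaf

theorem4p28 : (k : ℕ) → 1 ≤ k → {n : ℕ} → (G : Graph n) →
    IsKTree k G → IsCobipartite G → IsLinearKTree k G
theorem4p28 k _ {n} G T cob = T , shape
  where
  open KTreeConstruction-Properties T
  shape : (n ≡ suc k × IsComplete G) ⊎ ExactlyTwoOfDegree k G
  shape with suc k <? n
  ... | yes k+1<n = inj₂ (AfterInitialClique.exactlyTwoOfDegree k+1<n cob)
  ... | no  k+1≮n = inj₁ (n≡k+1 , n≡k+1⇒complete n≡k+1)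
    where
    n≡k+1 : n ≡ suc k
    n≡k+1 = ≤-antisym (≮⇒≥ k+1≮n) (KTreeConstruction.enough T)
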